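{- Let $\mathcal{G}$ be a graph class whose membership can be expressed in MSO logic. For any encoder $\mathcal{E}$, any function $g:\mathbb{N}\to\mathbb{N}$, and any positive integer $t$, the equivalence relation $\sim^*_{\mathcal{E},g,t,\mathcal{G}}$ has finite index; more precisely, its number of equivalence classes is at most $r(\mathcal{E},g,t,\mathcal{G}):=(g(t)+2)^{s_{\mathcal{E}}(t)}\cdot 2^t\cdot r_{\mathcal{G},t}$. In particular, the number of equivalence classes of $\sim_{\mathcal{E},g,t,\mathcal{G}}$ is at most $r(\mathcal{E},g,t,\mathcal{G})$ as well.
   Context: A $t$-boundaried graph is a graph $G$ with a set $\partial(G)\subseteq V(G)$ and an injective labeling $\lambda_G:\partial(G)\to\{1,\dots,t\}$; $\Lambda(G)=\lambda_G(\partial(G))$. $\mathcal{B}_t$: all $t$-boundaried graphs; $\mathcal{F}_t$: those of treewidth at most $t-1$ having a rooted tree decomposition of width at most $t-1$ whose root bag contains $\partial(G)$. $G_1\oplus G_2$: disjoint union with boundary vertices of equal labels identified. An encoder $\mathcal{E}=(\mathcal{C},L_\mathcal{C})$: $\mathcal{C}$ maps each finite $I\subseteq\mathbb{N}^+$ to a finite set $\mathcal{C}(I)$ of strings; $L_\mathcal{C}$ is a computable language of triples $(G,S,R)$ with $G$ boundaried, $S\subseteq V(G)$, $R\in\mathcal{C}(\Lambda(G))$. An encoder is of minimization or maximization type. Minimization: $f^{\mathcal{E}}_G(R)=\min\{|S|:(G,S,R)\in L_\mathcal{C}\}$ ($+\infty$ if none), and for $G\in\mathcal{B}_t$, $f^{\mathcal{E},g}_G(R)=+\infty$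 if $f^{\mathcal{E}}_G(R)-g(t)>\min_{R'\in\mathcal{C}(\Lambda(G))}f^{\mathcal{E}}_G(R')$, else $f^{\mathcal{E}}_G(R)$. Maximization: $f^{\mathcal{E}}_G(R)=\max\{|S|:(G,S,R)\in L_\mathcal{C}\}$ ($-\infty$ if none) and $f^{\mathcal{E},g}_G(R)=-\infty$ if $f^{\mathcal{E}}_G(R)+g(t)<\max_{R'}f^{\mathcal{E}}_G(R')$, else $f^{\mathcal{E}}_G(R)$. $s_\mathcal{E}(t)=\max_{I\subseteq\{1,\dots,t\}}|\mathcal{C}(I)|$. $G_1\sim^*_{\mathcal{E},g,t}G_2$ ($G_1,G_2\in\mathcal{B}_t$) iff $\Lambda(G_1)=\Lambda(G_2)=I$ and there is an integer $c$ with $f^{\mathcal{E},g}_{G_1}(R)=f^{\mathcal{E},g}_{G_2}(R)+c$ for all $R\in\mathcal{C}(I)$. For $G_1,G_2\in\mathcal{B}_t\cap\mathcal{G}$: $G_1\sim_{\mathcal{G},t}G_2$ iff for all $K\in\mathcal{B}_t$, $G_1\oplus K\in\mathcal{G}\Leftrightarrow G_2\oplus K\in\mathcal{G}$; $r_{\mathcal{G},t}$ is the (finite) number of classes of $\sim_{\mathcal{G},t}$. $G_1\sim^*_{\mathcal{E},g,t,\mathcal{G}}G_2$ iff $G_1\sim^*_{\mathcal{E},g,t}G_2$ and $G_1\sim_{\mathcal{G},t}G_2$; $\sim_{\mathcal{E},g,t,\mathcal{G}}$ is its restriction to $\mathcal{F}_t\cap\mathcal{G}$. -}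

module Defs where

open import Data.Nat using (ℕ; zero; suc; _+_; _*_; _^_; _≤_; _⊔_)
open import Data.Nat.Base using (_<ᵇ_; _≡ᵇ_; _≤ᵇ_)
open import Data.Integer using (ℤ; +_) renaming (_+_ to _+ℤ_)
open import Data.Bool using (Bool; true; false; _∧_; _∨_; not; if_then_else_; T)
open import Data.Maybe using (Maybe; just; nothing; is-just)
open import Data.List using (List; []; _∷_; _++_; map; filterᵇ; upTo; allFin;
  catMaybes; head; cartesianProduct; length; foldr; lookup)
open import Data.Bool.ListAction using (any; all)
open import Data.List.Membership.Propositional using (_∈_)
open import Data.List.Relation.Unary.Unique.Propositional using (Unique)
open import Data.Vec using (Vec; []; _∷_) renaming (lookup to vlookup)
open import Data.Fin using (Fin; splitAt; _≟_; toℕ)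
open import Data.Fin.Subset using (Subset; ∣_∣)
open import Data.Sum using (inj₁; inj₂)
open import Data.Product using (Σ; _×_; _,_; proj₁; proj₂)
open import Data.String using (String)
open import Data.Unit using (⊤)
open import Data.Empty using (⊥)
open import Relation.Nullary using (does; ¬_)
open import Relation.Binary.PropositionalEquality using (_≡_; _≢_; refl; sym; trans; cong)

record Graph : Set where
  field
    n       : ℕ
    adj     : Fin n → Fin n → Bool
    adj-sym : ∀ u v → adj u v ≡ adj v u
    adj-irr : ∀ v → adj v v ≡ false
open Graph public

GraphClass : Set₁
GraphClass = Graph → Set

-- Boundaried graphs.  lab v ≡ just i  means v ∈ ∂(G) with λ_G(v) = i.
-- Labels are positive and λ_G is injective.

record BGraph : Set where
  field
    graph   : Graph
    lab     : Fin (n graph) → Maybe ℕ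
    lab-pos : ∀ v i → lab v ≡ just i → 1 ≤ i
    lab-inj : ∀ u v i → lab u ≡ just i → lab v ≡ just i → u ≡ v
open BGraph public

nV : BGraph → ℕ
nV G = n (graph G)

InB : ℕ → BGraph → Set
InB t G = ∀ v i → lab G v ≡ just i → i ≤ t

𝓑 : ℕ → Set
𝓑 t = Σ BGraph (InB t)

isLab : Maybe ℕ → ℕ → Bool
isLab (just j) i = j ≡ᵇ i
isLab nothing  i = false

labelUsed : BGraph → ℕ → Bool
labelUsed G i = any (λ v → isLab (lab G v) i) (allFin (nV G))

maxLabel : BGraph → ℕ
maxLabel G = foldr (λ v m → labOr0 (lab G v) ⊔ m) 0 (allFin (nV G))
  where
  labOr0 : Maybe ℕ → ℕ
  labOr0 (just j) = j
  labOr0 nothing  = 0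

range1 : ℕ → List ℕ
range1 m = map suc (upTo m)

-- Λ(G), finite subsets of ℕ⁺ being represented canonically as strictly
-- increasing lists
Λ : BGraph → List ℕ
Λ G = filterᵇ (labelUsed G) (range1 (maxLabel G))

-- Gluing G₁ ⊕ G₂ (result: the underlying graph).  Vertices are those of
-- G₁ followed by the vertices of G₂ not identified with a vertex of G₁.

findLabel : (G : BGraph) → ℕ → Maybe (Fin (nV G))
findLabel G i = head (filterᵇ (λ v → isLab (lab G v) i) (allFin (nV G)))

partner : (G₁ G₂ : BGraph) → Fin (nV G₁) → Maybe (Fin (nV G₂))
partner G₁ G₂ v with lab G₁ v
... | just i  = findLabel G₂ i
... | nothing = nothing

identified : (G₁ G₂ : BGraph) → Fin (nV G₂) → Bool
identified G₁ G₂ v with lab G₂ v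
... | just i  = is-just (findLabel G₁ i)
... | nothing = false

kept : (G₁ G₂ : BGraph) → List (Fin (nV G₂))
kept G₁ G₂ = filterᵇ (λ v → not (identified G₁ G₂ v)) (allFin (nV G₂))

bothAdj : (H : Graph) → Maybe (Fin (n H)) → Maybe (Fin (n H)) → Bool
bothAdj H (just a) (just b) = adj H a b
bothAdj H _        _        = false

bothAdj-sym : ∀ H x y → bothAdj H x y ≡ bothAdj H y x
bothAdj-sym H (just a) (just b) = adj-sym H a b
bothAdj-sym H (just a) nothing  = refl
bothAdj-sym H nothing  (just b) = refl
bothAdj-sym H nothing  nothing  = refl

bothAdj-irr : ∀ H x → bothAdj H x x ≡ false
bothAdj-irr H (just a) = adj-irr H a
bothAdj-irr H nothing  = refl

_⊕_ : BGraph → BGraph → Graph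
G₁ ⊕ G₂ = record
  { n       = N
  ; adj     = A
  ; adj-sym = λ x y → cong₂∨ (bothAdj-sym (graph G₁) (im₁ x) (im₁ y))
                              (bothAdj-sym (graph G₂) (im₂ x) (im₂ y))
  ; adj-irr = λ x → irr∨ (bothAdj-irr (graph G₁) (im₁ x)) (bothAdj-irr (graph G₂) (im₂ x))
  }
  where
  N : ℕ
  N = nV G₁ + length (kept G₁ G₂)
  im₁ : Fin N → Maybe (Fin (nV G₁))
  im₁ x with splitAt (nV G₁) x
  ... | inj₁ a = just a
  ... | inj₂ _ = nothing
  im₂ : Fin N → Maybe (Fin (nV G₂))
  im₂ x with splitAt (nV G₁) x
  ... | inj₁ a = partner G₁ G₂ a
  ... | inj₂ j = just (lookup (kept G₁ G₂) j)
  A : Fin N → Fin N → Bool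
  A x y = bothAdj (graph G₁) (im₁ x) (im₁ y) ∨ bothAdj (graph G₂) (im₂ x) (im₂ y)
  cong₂∨ : ∀ {a b c d} → a ≡ b → c ≡ d → (a ∨ c) ≡ (b ∨ d)
  cong₂∨ refl refl = refl
  irr∨ : ∀ {a b} → a ≡ false → b ≡ false → (a ∨ b) ≡ false
  irr∨ refl refl = refl

-- MSO logic on graphs (MSO₂: vertex, edge, vertex-set, edge-set variables).
-- Variables are natural numbers; each sort has its own namespace.

data MSO : Set where
  eqV  : ℕ → ℕ → MSO
  eqE  : ℕ → ℕ → MSO
  adjV : ℕ → ℕ → MSO
  inc  : ℕ → ℕ → MSO
  memV : ℕ → ℕ → MSO
  memE : ℕ → ℕ → MSO
  neg  : MSO → MSO
  conj : MSO → MSO → MSO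
  exV  : ℕ → MSO → MSO
  exE  : ℕ → MSO → MSO
  exVS : ℕ → MSO → MSO
  exES : ℕ → MSO → MSO

-- Edges of H as pairs (u , v) with u < v
Edge : Graph → Set
Edge H = Fin (n H) × Fin (n H)

_<ᶠ_ : {m : ℕ} → Fin m → Fin m → Bool
a <ᶠ b = toℕ a <ᵇ toℕ b

edges : (H : Graph) → List (Edge H)
edges H = filterᵇ (λ p → (proj₁ p <ᶠ proj₂ p) ∧ adj H (proj₁ p) (proj₂ p))
                  (cartesianProduct (allFin (n H)) (allFin (n H)))

sublists : {A : Set} → List A → List (List A)
sublists []       = [] ∷ []
sublists (x ∷ xs) = let r = sublists xs in map (x ∷_) r ++ r

allSubsets : (m : ℕ) → List (Subset m)
allSubsets zero    = [] ∷ []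
allSubsets (suc m) = map (true ∷_) (allSubsets m) ++ map (false ∷_) (allSubsets m)

eqFin : {m : ℕ} → Fin m → Fin m → Bool
eqFin a b = does (a ≟ b)

eqEdge : {H : Graph} → Edge H → Edge H → Bool
eqEdge (a , b) (c , d) = eqFin a c ∧ eqFin b d

record Env (H : Graph) : Set where
  field
    vvar  : ℕ → Maybe (Fin (n H))
    evar  : ℕ → Maybe (Edge H)
    vsvar : ℕ → Maybe (Subset (n H))
    esvar : ℕ → Maybe (List (Edge H))
open Env public

emptyEnv : (H : Graph) → Env H
emptyEnv H = record { vvar = λ _ → nothing ; evar = λ _ → nothing
                    ; vsvar = λ _ → nothing ; esvar = λ _ → nothing }

upd : {A : Set} → (ℕ → Maybe A) → ℕ → A → ℕ → Maybe A
upd ρ x a y = if y ≡ᵇ x then just a else ρ y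

-- Boolean semantics (all quantifiers range over finite sets);
-- atoms mentioning an unbound variable are false.
sat : (H : Graph) → Env H → MSO → Bool
sat H ρ (eqV x y) with vvar ρ x | vvar ρ y
... | just a | just b = eqFin a b
... | _      | _      = false
sat H ρ (eqE x y) with evar ρ x | evar ρ y
... | just a | just b = eqEdge {H} a b
... | _      | _      = false
sat H ρ (adjV x y) with vvar ρ x | vvar ρ y
... | just a | just b = adj H a b
... | _      | _      = false
sat H ρ (inc x e) with vvar ρ x | evar ρ e
... | just a | just (u , v) = eqFin a u ∨ eqFin a v
... | _      | _            = false
sat H ρ (memV x X) with vvar ρ x | vsvar ρ X
... | just a | just S = vlookup S a
... | _      | _      = false
sat H ρ (memE e Y) with evar ρ e | esvar ρ Y
... | just a | just S = any (eqEdge {H} a) S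
... | _      | _      = false
sat H ρ (neg φ)    = not (sat H ρ φ)
sat H ρ (conj φ ψ) = sat H ρ φ ∧ sat H ρ ψ
sat H ρ (exV x φ)  = any (λ a → sat H (record ρ { vvar = upd (vvar ρ) x a }) φ) (allFin (n H))
sat H ρ (exE x φ)  = any (λ a → sat H (record ρ { evar = upd (evar ρ) x a }) φ) (edges H)
sat H ρ (exVS x φ) = any (λ a → sat H (record ρ { vsvar = upd (vsvar ρ) x a }) φ) (allSubsets (n H))
sat H ρ (exES x φ) = any (λ a → sat H (record ρ { esvar = upd (esvar ρ) x a }) φ) (sublists (edges H))

_⊨_ : Graph → MSO → Set
H ⊨ φ = T (sat H (emptyEnv H) φ)

MSOExpressible : GraphClass → Set
MSOExpressible 𝒢 = Σ MSO λ φ → ∀ H → (𝒢 H → H ⊨ φ) × (H ⊨ φ → 𝒢 H)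

data Kind : Set where
  minimization maximization : Kind

-- C maps a finite set I ⊆ ℕ⁺ (given as its strictly increasing list of
-- elements) to a finite set C(I) of strings (a duplicate-free list).
-- The computable language L_C is given by its (total) Boolean decision
-- procedure on triples (G , S , R), S ⊆ V(G).
record Encoder : Set where
  field
    kind     : Kind
    C        : List ℕ → List String
    C-unique : ∀ I → Unique (C I)
    L        : (G : BGraph) → Subset (nV G) → String → Bool
open Encoder public

minimumM : List ℕ → Maybe ℕ
minimumM []       = nothing
minimumM (x ∷ xs) with minimumM xs
... | nothing = just x
... | just y  = just (if x ≤ᵇ y then x else y)

maximumM : List ℕ → Maybe ℕ
maximumM []       = nothing
maximumM (x ∷ xs) with maximumM xs
... | nothing = just x
... | just y  = just (x ⊔ y)

optimum : Kind → List ℕ → Maybe ℕ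
optimum minimization = minimumM
optimum maximization = maximumM

-- f^𝓔_G(R);  nothing stands for +∞ (minimization) / -∞ (maximization)
fE : Encoder → (G : BGraph) → String → Maybe ℕ
fE E G R = optimum (kind E)
  (map ∣_∣ (filterᵇ (λ S → L E G S R) (allSubsets (nV G))))

bestE : Encoder → BGraph → Maybe ℕ
bestE E G = optimum (kind E) (catMaybes (map (fE E G) (C E (Λ G))))

prune : Kind → ℕ → Maybe ℕ → Maybe ℕ → Maybe ℕ
prune minimization d (just k) (just b) = if b + d <ᵇ k then nothing else just k
prune maximization d (just k) (just b) = if k + d <ᵇ b then nothing else just k
prune _            _ v        _        = v

fEg : Encoder → (ℕ → ℕ) → ℕ → BGraph → String → Maybe ℕ
fEg E g t G R = prune (kind E) (g t) (fE E G R) (bestE E G)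

ShiftEq : Maybe ℕ → Maybe ℕ → ℤ → Set
ShiftEq nothing  nothing  c = ⊤
ShiftEq (just a) (just b) c = (+ a) ≡ (+ b) +ℤ c
ShiftEq _        _        c = ⊥

sE : Encoder → ℕ → ℕ
sE E t = foldr (λ I m → length (C E I) ⊔ m) 0 (sublists (range1 t))

Sim* : Encoder → (ℕ → ℕ) → (t : ℕ) → 𝓑 t → 𝓑 t → Set
Sim* E g t (G₁ , _) (G₂ , _) =
  (Λ G₁ ≡ Λ G₂) ×
  Σ ℤ λ c → ∀ R → R ∈ C E (Λ G₁) → ShiftEq (fEg E g t G₁ R) (fEg E g t G₂ R) c

Dom : ℕ → GraphClass → Set
Dom t 𝒢 = Σ (𝓑 t) λ G → 𝒢 (graph (proj₁ G))

SimG : (𝒢 : GraphClass) → (t : ℕ) → Dom t 𝒢 → Dom t 𝒢 → Set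
SimG 𝒢 t ((G₁ , _) , _) ((G₂ , _) , _) =
  ∀ (K : 𝓑 t) → (𝒢 (G₁ ⊕ proj₁ K) → 𝒢 (G₂ ⊕ proj₁ K)) × (𝒢 (G₂ ⊕ proj₁ K) → 𝒢 (G₁ ⊕ proj₁ K))

Sim*G : Encoder → (ℕ → ℕ) → (t : ℕ) → (𝒢 : GraphClass) → Dom t 𝒢 → Dom t 𝒢 → Set
Sim*G E g t 𝒢 x y = Sim* E g t (proj₁ x) (proj₁ y) × SimG 𝒢 t x y

data RTree (m : ℕ) : Set where
  node : Subset m → List (RTree m) → RTree m

rootBag : {m : ℕ} → RTree m → Subset m
rootBag (node B _) = B

mutual
  anyBag : {m : ℕ} → (Subset m → Bool) → RTree m → Bool
  anyBag p (node B ts) = p B ∨ anyBagL p ts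

  anyBagL : {m : ℕ} → (Subset m → Bool) → List (RTree m) → Bool
  anyBagL p []       = false
  anyBagL p (t ∷ ts) = anyBag p t ∨ anyBagL p ts

mutual
  allBag : {m : ℕ} → (Subset m → Bool) → RTree m → Bool
  allBag p (node B ts) = p B ∧ allBagL p ts

  allBagL : {m : ℕ} → (Subset m → Bool) → List (RTree m) → Bool
  allBagL p []       = true
  allBagL p (t ∷ ts) = allBag p t ∧ allBagL p ts

occurs : {m : ℕ} → Fin m → RTree m → Bool
occurs v = anyBag (λ B → vlookup B v)

countOcc : {m : ℕ} → Fin m → List (RTree m) → ℕ
countOcc v []       = 0
countOcc v (t ∷ ts) = (if occurs v t then 1 else 0) + countOcc v ts

mutual
  -- the nodes whose bags contain v induce a connected subtree
  connected : {m : ℕ} → Fin m → RTree m → Bool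
  connected v (node B ts) =
    connectedL v ts ∧
    (if vlookup B v
       then all (λ c → not (occurs v c) ∨ vlookup (rootBag c) v) ts
       else countOcc v ts ≤ᵇ 1)

  connectedL : {m : ℕ} → Fin m → List (RTree m) → Bool
  connectedL v []       = true
  connectedL v (t ∷ ts) = connected v t ∧ connectedL v ts

record IsTreeDecomposition (H : Graph) (D : RTree (n H)) : Set where
  field
    vertexCover : ∀ v → T (occurs v D)
    edgeCover   : ∀ u v → adj H u v ≡ true → T (anyBag (λ B → vlookup B u ∧ vlookup B v) D)
    connectivity : ∀ v → T (connected v D)

-- width ≤ w - 1  ⇔  every bag has at most w vertices
WidthAtMostPred : {m : ℕ} → ℕ → RTree m → Set
WidthAtMostPred w D = T (allBag (λ B → ∣ B ∣ ≤ᵇ w) D)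

InF : ℕ → BGraph → Set
InF t G = Σ (RTree (nV G)) λ D →
  IsTreeDecomposition (graph G) D × WidthAtMostPred t D ×
  (∀ v i → lab G v ≡ just i → T (vlookup (rootBag D) v))

DomF : ℕ → GraphClass → Set
DomF t 𝒢 = Σ (Dom t 𝒢) λ x → InF t (proj₁ (proj₁ x))

SimF : Encoder → (ℕ → ℕ) → (t : ℕ) → (𝒢 : GraphClass) → DomF t 𝒢 → DomF t 𝒢 → Set
SimF E g t 𝒢 x y = Sim*G E g t 𝒢 (proj₁ x) (proj₁ y)

-- "R has at most N equivalence classes on A": among any N+1 elements,
-- two (at distinct positions) are related.
AtMostClasses : (A : Set) → (A → A → Set) → ℕ → Set
AtMostClasses A R N =
  (xs : Fin (suc N) → A) → Σ (Fin (suc N)) λ i → Σ (Fin (suc N)) λ j → (i ≢ j) × R (xs i) (xs j)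

-- r(𝓔,g,t,𝒢) with r_{𝒢,t} replaced by N
rBound : Encoder → (ℕ → ℕ) → ℕ → ℕ → ℕ
rBound E g t N = (g t + 2) ^ sE E t * 2 ^ t * N

{-# OPTIONS --safe #-}
-- Give each G ∈ 𝓑_t the code (Λ(G), (|f^{𝓔,g}_G(R) − best_G|)_{R ∈ C(Λ(G))}), where best_G
-- is the optimum of f^𝓔_G over C(Λ(G)).  After pruning every finite entry is at most g(t),
-- and Λ(G) ⊆ {1,…,t}, so there are at most 2^t (g(t)+2)^{s_𝓔(t)} codes; equal codes give
-- G₁ ∼*_{𝓔,g,t} G₂ with shift c = best_{G₁} − best_{G₂}.  Among r(𝓔,g,t,𝒢) + 1 graphs,
-- N + 1 share a code by pigeonhole, and two of those are ∼_{𝒢,t}-related.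
module Submission where

open import Defs
open import Data.Nat using (ℕ; _≤_)
open import Data.Product using (_×_)
open import Data.Product using (∃; ∃₂; ∃-syntax; _,_; proj₁; proj₂)

open import Data.Nat using (zero; suc; _+_; _*_; _^_; _∸_; _<_; _⊔_; _<ᵇ_; _≤ᵇ_; z≤n; s≤s)
open import Data.Nat.Properties
open import Data.Bool using (Bool; true; false; T; if_then_else_)
open import Data.Fin using (Fin; zero; suc; inject≤)
open import Data.Fin.Properties using (inject≤-injective)
open import Data.Integer using (ℤ; +_; -_; _⊖_) renaming (_+_ to _+ℤ_; _-_ to _-ℤ_)
open import Data.Integer.Properties using (pos-+; m-n≡m⊖n; ⊖-≥)
open import Data.Integer.Tactic.RingSolver using (solve-∀)
open import Data.List using (List; []; _∷_; _++_; map; length; lookup; filter; filterᵇ; concatMap; foldr;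
  catMaybes; applyUpTo; upTo; allFin)
open import Data.List.Properties using (length-map; length-upTo; length-tabulate; map-upTo; ∷-injective)
import Data.List.Properties as List
open import Data.List.Membership.Propositional using (_∈_; lose)
open import Data.List.Membership.Propositional.Properties using (∈-map⁺; ∈-++⁺ˡ; ∈-++⁺ʳ;
  ∈-concatMap⁺; ∈-lookup; ∈-upTo⁺)
open import Data.List.Relation.Unary.All as All using (All; []; _∷_)
open import Data.List.Relation.Unary.All.Properties using (all-filter; filter⁺; map⁺)
open import Data.List.Relation.Unary.Any using (here; there; satisfied)
open import Data.List.Relation.Unary.Any.Properties using (any⁻)
open import Data.List.Relation.Unary.AllPairs using (_∷_)
open import Data.List.Relation.Unary.Unique.Propositional using (Unique)
import Data.List.Relation.Unary.Unique.Propositional.Properties as Unique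
open import Data.Maybe using (Maybe; just; nothing; fromMaybe)
import Data.Maybe as Maybe
open import Data.Maybe.Properties using (just-injective)
import Data.Maybe.Properties as Maybe
import Data.Product.Properties as Product
open import Data.String using (String)
open import Data.Unit using (tt)
open import Function using (_∘_; _on_)
open import Relation.Binary.Definitions using (DecidableEquality)
open import Relation.Binary.PropositionalEquality using (_≡_; refl; sym; trans; cong; cong₂; subst; subst₂;
  module ≡-Reasoning)
open import Relation.Nullary using (¬_; Dec; does; yes; no; contradiction)
open import Relation.Unary.Properties using (∁?)
open import Relation.Nullary.Reflects using (ofʸ; ofⁿ)

private
  variable
    A B X Y : Set

-- Pigeonhole principle for fibres

lookup-injective : ∀ {xs : List A} → Unique xs → ∀ {i j} → lookup xs i ≡ lookup xs j → i ≡ j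
lookup-injective (_ ∷ _)      {zero}  {zero}  _  = refl
lookup-injective (x∉xs ∷ _)   {zero}  {suc j} eq = contradiction eq (All.lookup x∉xs (∈-lookup j))
lookup-injective (x∉xs ∷ _)   {suc i} {zero}  eq = contradiction (sym eq) (All.lookup x∉xs (∈-lookup i))
lookup-injective (_ ∷ xs-uniq) {suc i} {suc j} eq = cong suc (lookup-injective xs-uniq eq)

length-filter-∁ : ∀ {P : A → Set} (P? : ∀ x → Dec (P x)) xs →
                  length (filter P? xs) + length (filter (∁? P?) xs) ≡ length xs
length-filter-∁ P? []       = refl
length-filter-∁ P? (x ∷ xs) with does (P? x)
... | true  = cong suc (length-filter-∁ P? xs)
... | false = trans (+-suc _ _) (cong suc (length-filter-∁ P? xs))

module _ (_≟_ : DecidableEquality A) (f : B → A) (N : ℕ) where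

  in-fibre? : (a : A) → ∀ x → Dec (f x ≡ a)
  in-fibre? a x = f x ≟ a

  large-fibre : ∀ (P : List A) {xs} → Unique xs → All (λ x → f x ∈ P) xs → length P * N < length xs →
                ∃₂ λ a ys → Unique ys × N < length ys × All (λ y → f y ≡ a) ys
  large-fibre []      {_ ∷ _} _ (() ∷ _) _
  large-fibre (a ∷ P) {xs} xs-uniq xs⊆P |xs|> with N <? length (filter (in-fibre? a) xs)
  ... | yes big   =
    a , filter (in-fibre? a) xs , Unique.filter⁺ (in-fibre? a) xs-uniq , big , all-filter (in-fibre? a) xs
  ... | no  small = large-fibre P (Unique.filter⁺ (∁? (in-fibre? a)) xs-uniq) rest⊆P |rest|>
    where
    rest : List B
    rest = filter (∁? (in-fibre? a)) xs
    rest⊆P : All (λ x → f x ∈ P) rest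
    rest⊆P = All.zipWith (λ { (here fx≡a , fx≢a) → contradiction fx≡a fx≢a ; (there fx∈P , _) → fx∈P })
               (filter⁺ (∁? (in-fibre? a)) xs⊆P , all-filter (∁? (in-fibre? a)) xs)
    |rest|> : length P * N < length rest
    |rest|> = +-cancelˡ-< N _ _ (begin-strict
      N + length P * N                               <⟨ |xs|> ⟩
      length xs                                      ≡⟨ sym (length-filter-∁ (in-fibre? a) xs) ⟩
      length (filter (in-fibre? a) xs) + length rest ≤⟨ +-monoˡ-≤ (length rest) (≮⇒≥ small) ⟩
      N + length rest                                ∎)
      where open ≤-Reasoning

large-fibre-injection : ∀ {M N} → DecidableEquality A → (f : Fin M → A) (P : List A) →
                        (∀ k → f k ∈ P) → length P * N < M →
                        ∃ λ (pick : Fin (suc N) → Fin M) →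
                          (∀ {i j} → pick i ≡ pick j → i ≡ j) × (∀ i j → f (pick i) ≡ f (pick j))
large-fibre-injection {M = M} {N} _≟_ f P f∈P |P|N<M
  with _ , ys , ys-uniq , N<|ys| , ys-in-fibre
         ← large-fibre _≟_ f N P (Unique.allFin⁺ M) (All.tabulate λ {k} _ → f∈P k)
                       (subst (length P * N <_) (sym (length-tabulate (λ k → k))) |P|N<M)
  = (λ k → lookup ys (inject≤ k N<|ys|)) ,
    inject≤-injective _ _ _ _ ∘ lookup-injective ys-uniq ,
    λ i j → trans (All.lookup ys-in-fibre (∈-lookup _)) (sym (All.lookup ys-in-fibre (∈-lookup _)))

AtMostClasses-mono : ∀ {R : X → X → Set} {M N} → M ≤ N → AtMostClasses X R M → AtMostClasses X R N
AtMostClasses-mono M≤N R-classes xs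
  with i , j , i≢j , Rij ← R-classes (xs ∘ λ k → inject≤ k (s≤s M≤N))
  = inject≤ i _ , inject≤ j _ , i≢j ∘ inject≤-injective _ _ i j , Rij

AtMostClasses-restrict : ∀ {R : X → X → Set} {N} (h : Y → X) →
                         AtMostClasses X R N → AtMostClasses Y (R on h) N
AtMostClasses-restrict h R-classes xs = R-classes (h ∘ xs)

AtMostClasses-refine : ∀ {S T : X → X → Set} {N} → DecidableEquality A →
                       (code : X → A) (P : List A) → (∀ x → code x ∈ P) →
                       (∀ {x y} → code x ≡ code y → S x y → T x y) →
                       AtMostClasses X S N → AtMostClasses X T (length P * N)
AtMostClasses-refine _≟_ code P code∈P refines S-classes xs
  with pick , pick-injective , same-code ← large-fibre-injection _≟_ (code ∘ xs) P (code∈P ∘ xs) ≤-refl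
  with i , j , i≢j , Sij ← S-classes (xs ∘ pick)
  = pick i , pick j , i≢j ∘ pick-injective , refines (same-code i j) Sij

-- Finite enumerations

length-concatMap-≤ : ∀ (f : A → List B) xs {b} → (∀ {x} → x ∈ xs → length (f x) ≤ b) →
                     length (concatMap f xs) ≤ length xs * b
length-concatMap-≤ f []       _      = z≤n
length-concatMap-≤ f (x ∷ xs) {b} bounded = begin
  length (f x ++ concatMap f xs)         ≡⟨ List.length-++ (f x) ⟩
  length (f x) + length (concatMap f xs) ≤⟨ +-mono-≤ (bounded (here refl))
                                                     (length-concatMap-≤ f xs (bounded ∘ there)) ⟩
  b + length xs * b                      ∎
  where open ≤-Reasoning

≤-foldr-⊔ : ∀ (h : A → ℕ) {x xs} → x ∈ xs → h x ≤ foldr (λ y m → h y ⊔ m) 0 xs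
≤-foldr-⊔ h (here refl) = m≤m⊔n _ _
≤-foldr-⊔ h {xs = y ∷ _} (there x∈xs) = ≤-trans (≤-foldr-⊔ h x∈xs) (m≤n⊔m (h y) _)

∈-catMaybes⁺ : ∀ {x : A} {xs} → just x ∈ xs → x ∈ catMaybes xs
∈-catMaybes⁺ {xs = just _ ∷ _}  (here refl)  = here refl
∈-catMaybes⁺ {xs = just _ ∷ _}  (there x∈xs) = there (∈-catMaybes⁺ x∈xs)
∈-catMaybes⁺ {xs = nothing ∷ _} (there x∈xs) = ∈-catMaybes⁺ x∈xs

map-≡⇒≗-∈ : ∀ {f h : A → B} {x xs} → map f xs ≡ map h xs → x ∈ xs → f x ≡ h x
map-≡⇒≗-∈ {xs = _ ∷ _} eq (here refl)  = proj₁ (∷-injective eq)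
map-≡⇒≗-∈ {xs = _ ∷ _} eq (there x∈xs) = map-≡⇒≗-∈ (proj₂ (∷-injective eq)) x∈xs

wordsOfLength : List A → ℕ → List (List A)
wordsOfLength as zero    = [] ∷ []
wordsOfLength as (suc k) = concatMap (λ a → map (a ∷_) (wordsOfLength as k)) as

length-wordsOfLength : ∀ (as : List A) k → length (wordsOfLength as k) ≤ length as ^ k
length-wordsOfLength as zero    = ≤-refl
length-wordsOfLength as (suc k) = ≤-trans
  (length-concatMap-≤ _ as λ _ → ≤-reflexive (length-map _ (wordsOfLength as k)))
  (*-monoʳ-≤ (length as) (length-wordsOfLength as k))

∈-wordsOfLength : ∀ {as xs : List A} → All (_∈ as) xs → xs ∈ wordsOfLength as (length xs)
∈-wordsOfLength []             = here refl
∈-wordsOfLength (x∈as ∷ xs⊆as) = ∈-concatMap⁺ _ (lose x∈as (∈-map⁺ _ (∈-wordsOfLength xs⊆as)))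

length-sublists : ∀ (xs : List A) → length (sublists xs) ≡ 2 ^ length xs
length-sublists []       = refl
length-sublists (x ∷ xs) = begin
  length (map (x ∷_) (sublists xs) ++ sublists xs)         ≡⟨ List.length-++ (map (x ∷_) (sublists xs)) ⟩
  length (map (x ∷_) (sublists xs)) + length (sublists xs) ≡⟨ cong (_+ _) (length-map _ (sublists xs)) ⟩
  length (sublists xs) + length (sublists xs)              ≡⟨ cong (λ n → n + n) (length-sublists xs) ⟩
  2 ^ length xs + 2 ^ length xs                            ≡⟨ cong (λ n → 2 ^ length xs + n) (sym (+-identityʳ _)) ⟩
  2 ^ suc (length xs)                                      ∎
  where open ≡-Reasoning

[]∈sublists : ∀ (xs : List A) → [] ∈ sublists xs
[]∈sublists []       = here refl
[]∈sublists (x ∷ xs) = ∈-++⁺ʳ _ ([]∈sublists xs)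

∷-∈-sublists : ∀ {x : A} xs {ys} → ys ∈ sublists xs → x ∷ ys ∈ sublists (x ∷ xs)
∷-∈-sublists xs ys∈ = ∈-++⁺ˡ (∈-map⁺ _ ys∈)

∈-sublists-∷ : ∀ {x : A} xs {ys} → ys ∈ sublists xs → ys ∈ sublists (x ∷ xs)
∈-sublists-∷ {x = x} xs ys∈ = ∈-++⁺ʳ (map (x ∷_) (sublists xs)) ys∈

filterᵇ-applyUpTo-∈-sublists : ∀ (p : A → Bool) (f : ℕ → A) m n →
                               (∀ i → n ≤ i → ¬ T (p (f i))) →
                               filterᵇ p (applyUpTo f m) ∈ sublists (applyUpTo f n)
filterᵇ-applyUpTo-∈-sublists p f zero    n       _   = []∈sublists (applyUpTo f n)
filterᵇ-applyUpTo-∈-sublists p f (suc m) zero    out with p (f 0) | out 0 z≤n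
... | true  | ¬T = contradiction tt ¬T
... | false | _  = filterᵇ-applyUpTo-∈-sublists p (f ∘ suc) m zero λ i _ → out (suc i) z≤n
filterᵇ-applyUpTo-∈-sublists p f (suc m) (suc n) out with p (f 0)
... | true  = ∷-∈-sublists (applyUpTo (f ∘ suc) n)
                (filterᵇ-applyUpTo-∈-sublists p (f ∘ suc) m n λ i n≤i → out (suc i) (s≤s n≤i))
... | false = ∈-sublists-∷ (applyUpTo (f ∘ suc) n)
                (filterᵇ-applyUpTo-∈-sublists p (f ∘ suc) m n λ i n≤i → out (suc i) (s≤s n≤i))

isLab⇒≡just : ∀ m {i} → T (isLab m i) → m ≡ just i
isLab⇒≡just (just j) {i} j≡ᵇi = cong just (≡ᵇ⇒≡ j i j≡ᵇi)

¬labelUsed-beyond : ∀ {t G i} → InB t G → t < i → ¬ T (labelUsed G i)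
¬labelUsed-beyond {G = G} {i} G∈𝓑 t<i used
  with v , v-labelled-i ← satisfied (any⁻ (λ v → isLab (lab G v) i) (allFin (nV G)) used)
  = <⇒≱ t<i (G∈𝓑 v i (isLab⇒≡just (lab G v) v-labelled-i))

Λ-∈-sublists : ∀ {t G} → InB t G → Λ G ∈ sublists (range1 t)
Λ-∈-sublists {t} {G} G∈𝓑 =
  subst₂ (λ xs ys → filterᵇ (labelUsed G) xs ∈ sublists ys)
         (sym (map-upTo suc (maxLabel G))) (sym (map-upTo suc t))
         (filterᵇ-applyUpTo-∈-sublists (labelUsed G) suc (maxLabel G) t
           λ i t≤i → ¬labelUsed-beyond {t} {G} G∈𝓑 (s≤s t≤i))

-- Optima and pruning

Dominates : Kind → ℕ → ℕ → Set
Dominates minimization b k = b ≤ k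
Dominates maximization b k = k ≤ b

gap : Kind → ℕ → ℕ → ℕ
gap minimization b k = k ∸ b
gap maximization b k = b ∸ k

offset : Kind → ℕ → ℤ
offset minimization γ = + γ
offset maximization γ = - (+ γ)

+k≡+b+offset[gap] : ∀ kd {b k} → Dominates kd b k → + k ≡ + b +ℤ offset kd (gap kd b k)
+k≡+b+offset[gap] minimization {b} {k} b≤k = begin
  + k                ≡⟨ cong +_ (sym (m+[n∸m]≡n b≤k)) ⟩
  + (b + (k ∸ b))    ≡⟨ pos-+ b (k ∸ b) ⟩
  + b +ℤ + (k ∸ b)   ∎
  where open ≡-Reasoning
+k≡+b+offset[gap] maximization {b} {k} k≤b = begin
  + k                ≡⟨ cong +_ (sym (m∸[m∸n]≡n k≤b)) ⟩
  + (b ∸ (b ∸ k))    ≡⟨ sym (⊖-≥ (m∸n≤m b k)) ⟩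
  b ⊖ (b ∸ k)        ≡⟨ sym (m-n≡m⊖n b (b ∸ k)) ⟩
  + b -ℤ + (b ∸ k)   ∎
  where open ≡-Reasoning

if-≤ᵇ-≤ : ∀ x y → (if x ≤ᵇ y then x else y) ≤ x × (if x ≤ᵇ y then x else y) ≤ y
if-≤ᵇ-≤ x y with x ≤ᵇ y | ≤ᵇ-reflects-≤ x y
... | true  | ofʸ x≤y = ≤-refl , x≤y
... | false | ofⁿ x≰y = <⇒≤ (≰⇒> x≰y) , ≤-refl

minimumM-≤ : ∀ {xs k} → k ∈ xs → ∃[ b ] minimumM xs ≡ just b × b ≤ k
minimumM-≤ {x ∷ xs} (here refl) with minimumM xs
... | nothing = x , refl , ≤-refl
... | just y  = _ , refl , proj₁ (if-≤ᵇ-≤ x y)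
minimumM-≤ {x ∷ xs} (there k∈xs) with minimumM xs | minimumM-≤ k∈xs
... | just y | _ , refl , y≤k = _ , refl , ≤-trans (proj₂ (if-≤ᵇ-≤ x y)) y≤k

maximumM-≥ : ∀ {xs k} → k ∈ xs → ∃[ b ] maximumM xs ≡ just b × k ≤ b
maximumM-≥ {x ∷ xs} (here refl) with maximumM xs
... | nothing = x , refl , ≤-refl
... | just y  = _ , refl , m≤m⊔n x y
maximumM-≥ {x ∷ xs} (there k∈xs) with maximumM xs | maximumM-≥ k∈xs
... | just y | _ , refl , k≤y = _ , refl , ≤-trans k≤y (m≤n⊔m x y)

optimum-dominates : ∀ kd {xs k} → k ∈ xs → ∃[ b ] optimum kd xs ≡ just b × Dominates kd b k
optimum-dominates minimization = minimumM-≤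
optimum-dominates maximization = maximumM-≥

prune-nothing : ∀ kd d y → prune kd d nothing y ≡ nothing
prune-nothing minimization d y = refl
prune-nothing maximization d y = refl

prune-near : ∀ kd d {b k₀ k} → Dominates kd b k₀ → prune kd d (just k₀) (just b) ≡ just k →
             Dominates kd b k × gap kd b k ≤ d
prune-near minimization d {b} {k₀} b≤k₀ eq with b + d <ᵇ k₀ | <ᵇ-reflects-< (b + d) k₀ | eq
... | false | ofⁿ k₀≰b+d | refl = b≤k₀ , m≤n+o⇒m∸n≤o k₀ b (≮⇒≥ k₀≰b+d)
prune-near maximization d {b} {k₀} k₀≤b eq with k₀ + d <ᵇ b | <ᵇ-reflects-< (k₀ + d) b | eq
... | false | ofⁿ b≰k₀+d | refl = k₀≤b , m≤n+o⇒m∸n≤o b k₀ (≮⇒≥ b≰k₀+d)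

ShiftEq-of-equal-gaps : ∀ kd {b₁ b₂} x y →
                        (∀ {k} → x ≡ just k → Dominates kd b₁ k) →
                        (∀ {k} → y ≡ just k → Dominates kd b₂ k) →
                        Maybe.map (gap kd b₁) x ≡ Maybe.map (gap kd b₂) y → ShiftEq x y (+ b₁ -ℤ + b₂)
ShiftEq-of-equal-gaps kd nothing   nothing   _ _ _ = tt
ShiftEq-of-equal-gaps kd {b₁} {b₂} (just k₁) (just k₂) b₁≽k₁ b₂≽k₂ same-gap = begin
  + k₁
    ≡⟨ +k≡+b+offset[gap] kd (b₁≽k₁ refl) ⟩
  + b₁ +ℤ offset kd (gap kd b₁ k₁)
    ≡⟨ cong (λ γ → + b₁ +ℤ offset kd γ) (just-injective same-gap) ⟩
  + b₁ +ℤ offset kd (gap kd b₂ k₂)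
    ≡⟨ shift (+ b₁) (+ b₂) (offset kd (gap kd b₂ k₂)) ⟩
  (+ b₂ +ℤ offset kd (gap kd b₂ k₂)) +ℤ (+ b₁ -ℤ + b₂)
    ≡⟨ cong (_+ℤ (+ b₁ -ℤ + b₂)) (sym (+k≡+b+offset[gap] kd (b₂≽k₂ refl))) ⟩
  + k₂ +ℤ (+ b₁ -ℤ + b₂)
    ∎
  where
  open ≡-Reasoning
  shift : ∀ (b₁ b₂ o : ℤ) → b₁ +ℤ o ≡ (b₂ +ℤ o) +ℤ (b₁ -ℤ b₂)
  shift = solve-∀

-- Codes of boundaried graphs

boundedGaps : ℕ → List (Maybe ℕ)
boundedGaps d = nothing ∷ map just (upTo (suc d))

length-boundedGaps : ∀ d → length (boundedGaps d) ≡ 2 + d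
length-boundedGaps d = cong suc (trans (length-map just (upTo (suc d))) (length-upTo (suc d)))

map-∈-boundedGaps : ∀ {d} (f : ℕ → ℕ) x → (∀ {k} → x ≡ just k → f k ≤ d) →
                    Maybe.map f x ∈ boundedGaps d
map-∈-boundedGaps f nothing  _       = here refl
map-∈-boundedGaps f (just k) bounded = there (∈-map⁺ just (∈-upTo⁺ (s≤s (bounded refl))))

module Codes (E : Encoder) (g : ℕ → ℕ) (t : ℕ) where

  -- The junk value 0 (when f^𝓔_G is infinite on all of C(Λ(G))) is harmless:
  -- then every f^{𝓔,g}_G(R) is infinite as well.
  best : BGraph → ℕ
  best G = fromMaybe 0 (bestE E G)

  fEg-near-best : ∀ G {R k} → R ∈ C E (Λ G) → fEg E g t G R ≡ just k →
                  Dominates (kind E) (best G) k × gap (kind E) (best G) k ≤ g t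
  fEg-near-best G {R} R∈C eq with fE E G R in fE≡
  ... | nothing = contradiction (trans (sym (prune-nothing (kind E) (g t) (bestE E G))) eq) λ ()
  ... | just k₀
    with b , bestE≡b , b≽k₀ ← optimum-dominates (kind E)
           (∈-catMaybes⁺ (subst (_∈ map (fE E G) (C E (Λ G))) fE≡ (∈-map⁺ (fE E G) R∈C)))
    rewrite bestE≡b = prune-near (kind E) (g t) b≽k₀ eq

  profile : BGraph → String → Maybe ℕ
  profile G R = Maybe.map (gap (kind E) (best G)) (fEg E g t G R)

  Code : Set
  Code = List ℕ × List (Maybe ℕ)

  _≟ᶜ_ : DecidableEquality Code
  _≟ᶜ_ = Product.≡-dec (List.≡-dec _≟_) (List.≡-dec (Maybe.≡-dec _≟_))

  code : BGraph → Code
  code G = Λ G , map (profile G) (C E (Λ G))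

  profiles : List ℕ → List (List (Maybe ℕ))
  profiles I = wordsOfLength (boundedGaps (g t)) (length (C E I))

  codes : List Code
  codes = concatMap (λ I → map (I ,_) (profiles I)) (sublists (range1 t))

  profile∈boundedGaps : ∀ G {R} → R ∈ C E (Λ G) → profile G R ∈ boundedGaps (g t)
  profile∈boundedGaps G R∈C = map-∈-boundedGaps _ (fEg E g t G _) (proj₂ ∘ fEg-near-best G R∈C)

  code∈codes : ∀ {G} → InB t G → code G ∈ codes
  code∈codes {G} G∈𝓑 = ∈-concatMap⁺ _ (lose (Λ-∈-sublists {t} {G} G∈𝓑) (∈-map⁺ (Λ G ,_) profile∈profiles))
    where
    profile∈profiles : map (profile G) (C E (Λ G)) ∈ profiles (Λ G)
    profile∈profiles =
      subst (λ n → map (profile G) (C E (Λ G)) ∈ wordsOfLength (boundedGaps (g t)) n)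
            (length-map (profile G) (C E (Λ G)))
            (∈-wordsOfLength (map⁺ (All.tabulate (profile∈boundedGaps G))))

  length-codes : length codes ≤ (g t + 2) ^ sE E t * 2 ^ t
  length-codes = begin
    length codes
      ≤⟨ length-concatMap-≤ _ (sublists (range1 t)) length-profiles ⟩
    length (sublists (range1 t)) * (2 + g t) ^ sE E t
      ≡⟨ cong (_* ((2 + g t) ^ sE E t)) (length-sublists (range1 t)) ⟩
    2 ^ length (range1 t) * (2 + g t) ^ sE E t
      ≡⟨ cong₂ (λ m n → 2 ^ m * n ^ sE E t) (trans (length-map suc (upTo t)) (length-upTo t)) (+-comm 2 (g t)) ⟩
    2 ^ t * (g t + 2) ^ sE E t
      ≡⟨ *-comm (2 ^ t) _ ⟩
    (g t + 2) ^ sE E t * 2 ^ t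
      ∎
    where
    open ≤-Reasoning
    length-profiles : ∀ {I} → I ∈ sublists (range1 t) → length (map (I ,_) (profiles I)) ≤ (2 + g t) ^ sE E t
    length-profiles {I} I∈ = begin
      length (map (I ,_) (profiles I))             ≡⟨ length-map _ (profiles I) ⟩
      length (profiles I)                          ≤⟨ length-wordsOfLength (boundedGaps (g t)) (length (C E I)) ⟩
      length (boundedGaps (g t)) ^ length (C E I)  ≡⟨ cong (_^ length (C E I)) (length-boundedGaps (g t)) ⟩
      (2 + g t) ^ length (C E I)                   ≤⟨ ^-monoʳ-≤ (2 + g t) (≤-foldr-⊔ (λ I → length (C E I)) I∈) ⟩
      (2 + g t) ^ sE E t                           ∎

  same-code⇒Sim* : ∀ (G₁ G₂ : 𝓑 t) → code (proj₁ G₁) ≡ code (proj₁ G₂) → Sim* E g t G₁ G₂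
  same-code⇒Sim* (G₁ , _) (G₂ , _) same-code =
    Λ≡ , + best G₁ -ℤ + best G₂ , λ R R∈C →
      ShiftEq-of-equal-gaps (kind E) (fEg E g t G₁ R) (fEg E g t G₂ R)
        (proj₁ ∘ fEg-near-best G₁ R∈C)
        (proj₁ ∘ fEg-near-best G₂ (subst (λ I → R ∈ C E I) Λ≡ R∈C))
        (map-≡⇒≗-∈ same-profile R∈C)
    where
    Λ≡ : Λ G₁ ≡ Λ G₂
    Λ≡ = cong proj₁ same-code
    same-profile : map (profile G₁) (C E (Λ G₁)) ≡ map (profile G₂) (C E (Λ G₁))
    same-profile = trans (cong proj₂ same-code) (cong (λ I → map (profile G₂) (C E I)) (sym Λ≡))

lemma1 : (𝒢 : GraphClass) → MSOExpressible 𝒢 →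
           (E : Encoder) (g : ℕ → ℕ) (t : ℕ) → 1 ≤ t →
           (N : ℕ) → AtMostClasses (Dom t 𝒢) (SimG 𝒢 t) N →
           AtMostClasses (Dom t 𝒢) (Sim*G E g t 𝒢) (rBound E g t N)
             × AtMostClasses (DomF t 𝒢) (SimF E g t 𝒢) (rBound E g t N)
-- MSO-expressibility of 𝒢 is what makes r_{𝒢,t} finite in the paper; here that finiteness
-- is the hypothesis on N.
lemma1 𝒢 _ E g t _ N SimG-classes =
  Sim*G-classes , AtMostClasses-restrict {R = Sim*G E g t 𝒢} proj₁ Sim*G-classes
  where
  open Codes E g t
  Sim*G-classes : AtMostClasses (Dom t 𝒢) (Sim*G E g t 𝒢) (rBound E g t N)
  Sim*G-classes =
    AtMostClasses-mono {R = Sim*G E g t 𝒢} (*-monoˡ-≤ N length-codes)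
      (AtMostClasses-refine {S = SimG 𝒢 t} {T = Sim*G E g t 𝒢} _≟ᶜ_
        (code ∘ proj₁ ∘ proj₁) codes (code∈codes ∘ proj₂ ∘ proj₁)
        (λ {x} {y} same-code SimG-xy → same-code⇒Sim* (proj₁ x) (proj₁ y) same-code , SimG-xy)
        SimG-classes)
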